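{- Let $m>1$ be an integer such that $2m+1$ is prime. Let $P$ be the set of $(2m+1)$-tuples $(n_0,n_1,\dots,n_{2m})$ of nonnegative integers with $n_0=0$ and $n_1=n_2=\cdots=n_{m-1}=n_m+n_{m+1}=n_{m+2}=\cdots=n_{2m}$. A position $M=(n_0,\dots,n_{2m})$ of ${\rm ECN}((2m+1)_{\{1,2,\dots,m-1\}},2m-1)$ is a $\mathcal{P}$-position if and only if $M\in_\circlearrowleft P$.
   Context: Extended circular nim ${\rm ECN}(m_S,k)$ (here with $m$ replaced by the number of piles; positive integers $k\le$ number of piles, $S$ a set of positive integers each at most half the number of piles): there are $N$ piles $v_0,\dots,v_{N-1}$ arranged in a circle (indices mod $N$); a position is a tuple $(n_0,\dots,n_{N-1})$ of nonnegative integers, $n_i$ being the number of tokens on $v_i$. A move chooses $s\in S$, $i\in\{0,\dots,N-1\}$, $j\in\{0,\dots,k-1\}$ and removes an arbitrary nonnegative number of tokens from each pile $v_{(i+ts)\bmod N}$, $t=0,\dots,j$, removing at least one token in total (empty piles still count as piles). Normal play: the player unable to move loses. A $\mathcal{P}$-position is a position from which the previous player (the player who just moved) has a winning strategy. For a set $P$ of $N$-tuples and $M=(n_0,\dots,n_{N-1})$, $M\in_\circlearrowleft P$ means there exists $i<N$ such that $(n_i,n_{(i+1)\bmod N},\dots,n_{(i+N-1)\bmod N})\in P$ or $(n_i,n_{(i+N-1)\bmod N},\dots,n_{(i+1)\bmod N})\in P$. -}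

module Defs where

open import Data.Nat using (ℕ; zero; suc; _+_; _*_; _∸_; _≤_; _<_; NonZero)
open import Data.Nat.DivMod using (_mod_)
open import Data.Fin using (Fin; toℕ)
open import Data.Product using (Σ; ∃; _×_; _,_)
open import Data.Sum using (_⊎_)
open import Relation.Binary.PropositionalEquality using (_≡_)
open import Relation.Nullary using (¬_)

Position : ℕ → Set
Position N = Fin N → ℕ

InGroup : (N : ℕ) .{{_ : NonZero N}} → (s : ℕ) → Fin N → (j : ℕ) → Fin N → Set
InGroup N s i j p = Σ ℕ λ t → t ≤ j × p ≡ (toℕ i + t * s) mod N

-- One move of ECN(N_S, k), where S is given as a predicate on ℕ:
-- choose s ∈ S, i < N, j < k; remove arbitrary numbers of tokens from the
-- piles of the group, at least one token in total; other piles unchanged.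
Move : (N : ℕ) .{{_ : NonZero N}} → (S : ℕ → Set) → (k : ℕ) →
       Position N → Position N → Set
Move N S k M M' =
  Σ ℕ λ s → S s × Σ (Fin N) λ i → Σ ℕ λ j → j < k ×
    ((∀ p → M' p ≤ M p) ×
     (∀ p → ¬ InGroup N s i j p → M' p ≡ M p) ×
     Σ (Fin N) λ p → M' p < M p)

-- Normal play, inductively: Win M = the player to move has a winning strategy,
-- Lose M = the previous player has a winning strategy (P-position).
mutual
  data Win (N : ℕ) .{{_ : NonZero N}} (S : ℕ → Set) (k : ℕ) (M : Position N) : Set where
    win : (M' : Position N) → Move N S k M M' → Lose N S k M' → Win N S k M

  data Lose (N : ℕ) .{{_ : NonZero N}} (S : ℕ → Set) (k : ℕ) (M : Position N) : Set where
    lose : ((M' : Position N) → Move N S k M M' → Win N S k M') → Lose N S k M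

PPosition : (N : ℕ) .{{_ : NonZero N}} → (S : ℕ → Set) → (k : ℕ) → Position N → Set
PPosition = Lose

-- M ∈↺ P : some rotation or reflected rotation of M lies in P.
_∈↺_ : {N : ℕ} .{{_ : NonZero N}} → Position N → (Position N → Set) → Set
_∈↺_ {N} M P = Σ (Fin N) λ i →
  P (λ r → M ((toℕ i + toℕ r) mod N)) ⊎ P (λ r → M ((toℕ i + (N ∸ toℕ r)) mod N))

S₁ : ℕ → ℕ → Set
S₁ m s = 1 ≤ s × s < m

PSet : (m : ℕ) → Position (suc (2 * m)) → Set
PSet m x =
  at 0 ≡ 0 ×
  Σ ℕ λ c → ((r : ℕ) → 1 ≤ r → r < m → at r ≡ c) ×
            (at m + at (suc m) ≡ c) ×
            ((r : ℕ) → suc (suc m) ≤ r → r ≤ 2 * m → at r ≡ c)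
  where
    at : ℕ → ℕ
    at r = x (r mod suc (2 * m))

-- Since 2m+1 is prime, the 2m-1 piles i, i+s, …, i+(2m-2)s of a longest move are all piles except
-- i-2s and i-s, so the moves are exactly the decreases that leave two piles at circular distance
-- s < m unchanged.  The rotations and reflections of P are then the kernel of the game.
-- Independence: an element of P with pair sum c holds (2m-1)c tokens, so a move between two of them
-- lowers c to c' < c.  The two unchanged piles hold fewer than c tokens, hence are the pair n_m, n_{m+1}
-- of the first position and still hold c tokens, while the empty pile of the first position bounds
-- them by c' in the second.
-- Absorption: with u a smallest pile, aim for the element of P whose pair is {u-1, u} or {u, u+1};
-- when both attempts fail, their obstructions make the element of P with empty pile u reachable.
module Submission where

open import Defs
open import Data.Empty using (⊥)
open import Data.Fin using (Fin; toℕ; punchOut) renaming (zero to fzero; suc to fsuc; _≟_ to _≟ᶠ_)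
open import Data.Fin.Properties
  using (toℕ-fromℕ<; toℕ-injective; toℕ<n; any?; punchOut-injective; injective⇒≤)
open import Data.List using (List; filter; allFin)
open import Data.List.Extrema.Nat using (argmin; argmin-all; f[argmin]≤f[xs])
open import Data.List.Membership.Propositional.Properties using (∈-filter⁺; ∈-allFin)
open import Data.List.Relation.Unary.All as All using ()
open import Data.List.Relation.Unary.All.Properties using (all-filter)
open import Data.Nat
  using ( ℕ; zero; suc; _+_; _*_; _∸_; _≤_; _<_; _≤?_; _<?_; z≤n; s≤s; s≤s⁻¹
        ; NonZero; >-nonZero; nonTrivial⇒n>1)
open import Data.Nat.DivMod
  using (_mod_; _%_; _/_; m%n<n; m<n⇒m%n≡m; [m+n]%n≡m%n; %-distribˡ-+; m≡m%n+[m/n]*n)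
open import Data.Nat.Divisibility using (_∣_; divides; ∣⇒≤)
open import Data.Nat.Induction using (<-wellFounded)
open import Data.Nat.Primality using (Prime; euclidsLemma; prime⇒nonZero; prime⇒nonTrivial)
open import Data.Nat.Properties
open import Algebra.Properties.CommutativeSemigroup +-commutativeSemigroup
  using (xy∙z≈zy∙x; xy∙z≈xz∙y; xy∙z≈x∙zy)
open import Algebra.Properties.Monoid.Sum +-0-monoid using (sum; sum-cong-≗)
open import Data.Nat.Tactic.RingSolver using (solve-∀)
open import Data.Product using (∃-syntax; _×_; _,_; proj₁; proj₂)
open import Data.Sum as Sum using (_⊎_; inj₁; inj₂)
open import Data.Unit using (⊤; tt)
open import Data.Vec.Functional using (updateAt; tail)
open import Data.Vec.Functional.Properties using (updateAt-updates; updateAt-minimal)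
open import Function using (_∘_; const)
open import Function.Definitions using (Injective)
open import Induction.WellFounded using (Acc; acc)
open import Relation.Binary.Definitions using (tri<; tri≈; tri>)
open import Relation.Binary.PropositionalEquality
open import Relation.Nullary using (¬_; Dec; yes; no; contradiction; ¬?)
open import Relation.Unary using (Decidable)

sum-const : ∀ n c → sum {n} (λ _ → c) ≡ n * c
sum-const zero    c = refl
sum-const (suc n) c = cong (c +_) (sum-const n c)

sum-mono-≤ : ∀ {n} {f g : Fin n → ℕ} → (∀ y → f y ≤ g y) → sum f ≤ sum g
sum-mono-≤ {zero}  f≤g = z≤n
sum-mono-≤ {suc n} f≤g = +-mono-≤ (f≤g fzero) (sum-mono-≤ (f≤g ∘ fsuc))

sum-mono-< : ∀ {n} {f g : Fin n → ℕ} → (∀ y → f y ≤ g y) → ∀ x → f x < g x → sum f < sum g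
sum-mono-< f≤g fzero    fx<gx = +-mono-<-≤ fx<gx (sum-mono-≤ (f≤g ∘ fsuc))
sum-mono-< f≤g (fsuc x) fx<gx = +-mono-≤-< (f≤g fzero) (sum-mono-< (f≤g ∘ fsuc) x fx<gx)

sum-updateAt : ∀ {n} (f : Fin n → ℕ) a h → sum (updateAt f a h) + f a ≡ sum f + h (f a)
sum-updateAt f fzero    h = xy∙z≈zy∙x (h (f fzero)) (sum (tail f)) (f fzero)
sum-updateAt f (fsuc a) h = begin
  f fzero + sum (updateAt (tail f) a h) + f (fsuc a)   ≡⟨ +-assoc (f fzero) _ _ ⟩
  f fzero + (sum (updateAt (tail f) a h) + f (fsuc a)) ≡⟨ cong (f fzero +_) (sum-updateAt (tail f) a h) ⟩
  f fzero + (sum (tail f) + h (f (fsuc a)))            ≡⟨ +-assoc (f fzero) _ _ ⟨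
  f fzero + sum (tail f) + h (f (fsuc a))              ∎
  where open ≡-Reasoning

injective⇒surjective : ∀ {n} (f : Fin n → Fin n) → Injective _≡_ _≡_ f → ∀ y → ∃[ x ] f x ≡ y
injective⇒surjective {suc n} f f-inj y with any? (λ x → f x ≟ᶠ y)
... | yes hit = hit
... | no miss = contradiction (injective⇒≤ g-inj) (<⇒≱ (n<1+n n))
  where
  y≢f : ∀ x → y ≢ f x
  y≢f x y≡fx = miss (x , sym y≡fx)
  g : Fin (suc n) → Fin n
  g x = punchOut (y≢f x)
  g-inj : Injective _≡_ _≡_ g
  g-inj {a} {b} = f-inj ∘ punchOut-injective (y≢f a) (y≢f b)

minimiser : ∀ {n} {P : Fin n → Set} → Decidable P → (f : Fin n → ℕ) → ∀ {w₀} → P w₀ →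
            ∃[ w ] P w × (∀ y → P y → f w ≤ f y)
minimiser {n} {P} P? f {w₀} Pw₀ = argmin f w₀ ys , argmin-all f Pw₀ (all-filter P? (allFin n)) , minimal
  where
  ys : List (Fin n)
  ys = filter P? (allFin n)
  minimal : ∀ y → P y → f (argmin f w₀ ys) ≤ f y
  minimal y Py = All.lookup (f[argmin]≤f[xs] {f = f} w₀ ys) (∈-filter⁺ P? (∈-allFin y) Py)

module Circle (N : ℕ) .{{_ : NonZero N}} where

  pile : ℕ → ℕ → Fin N
  pile z e = (z + e) mod N

  toℕ-mod : ∀ a → toℕ (a mod N) ≡ a % N
  toℕ-mod a = toℕ-fromℕ< (m%n<n a N)

  %⇒mod : ∀ {a b} → a % N ≡ b % N → a mod N ≡ b mod N
  %⇒mod {a} {b} eq = toℕ-injective (trans (toℕ-mod a) (trans eq (sym (toℕ-mod b))))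

  mod⇒% : ∀ {a b} → a mod N ≡ b mod N → a % N ≡ b % N
  mod⇒% {a} {b} eq = trans (sym (toℕ-mod a)) (trans (cong toℕ eq) (toℕ-mod b))

  mod-shift : ∀ {a b} k → a mod N ≡ b mod N → (a + k) mod N ≡ (b + k) mod N
  mod-shift {a} {b} k eq = %⇒mod (begin
    (a + k) % N         ≡⟨ %-distribˡ-+ a k N ⟩
    (a % N + k % N) % N ≡⟨ cong (λ v → (v + k % N) % N) (mod⇒% eq) ⟩
    (b % N + k % N) % N ≡⟨ %-distribˡ-+ b k N ⟨
    (b + k) % N         ∎)
    where open ≡-Reasoning

  mod-toℕ : ∀ (y : Fin N) → toℕ y mod N ≡ y
  mod-toℕ y = toℕ-injective (trans (toℕ-mod (toℕ y)) (m<n⇒m%n≡m (toℕ<n y)))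

  pile-toℕ : ∀ z e k → pile (toℕ (pile z e)) k ≡ pile z (e + k)
  pile-toℕ z e k = trans (mod-shift k (mod-toℕ (pile z e))) (cong (_mod N) (+-assoc z e k))

  pile-toℕ-0 : ∀ y → pile (toℕ y) 0 ≡ y
  pile-toℕ-0 y = trans (cong (_mod N) (+-identityʳ (toℕ y))) (mod-toℕ y)

  pile-shift : ∀ z e z' e' k → pile z e ≡ pile z' e' → pile z (e + k) ≡ pile z' (e' + k)
  pile-shift z e z' e' k eq = begin
    (z + (e + k)) mod N   ≡⟨ cong (_mod N) (+-assoc z e k) ⟨
    (z + e + k) mod N     ≡⟨ mod-shift k eq ⟩
    (z' + e' + k) mod N   ≡⟨ cong (_mod N) (+-assoc z' e' k) ⟩
    (z' + (e' + k)) mod N ∎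
    where open ≡-Reasoning

  pile-mod : ∀ z r → pile z (toℕ (r mod N)) ≡ pile z r
  pile-mod z r = begin
    (z + toℕ (r mod N)) mod N ≡⟨ cong (_mod N) (+-comm z _) ⟩
    (toℕ (r mod N) + z) mod N ≡⟨ mod-shift z (mod-toℕ (r mod N)) ⟩
    (r + z) mod N             ≡⟨ cong (_mod N) (+-comm r z) ⟩
    (z + r) mod N             ∎
    where open ≡-Reasoning

  pile-periodic : ∀ z e → pile z (e + N) ≡ pile z e
  pile-periodic z e = %⇒mod (trans (cong (_% N) (sym (+-assoc z e N))) ([m+n]%n≡m%n (z + e) N))

  pile-rebase : ∀ z a e → pile (z + a) e ≡ pile z (a + e)
  pile-rebase z a e = cong (_mod N) (+-assoc z a e)

  pile-rebase-0 : ∀ z a → pile (z + a) 0 ≡ pile z a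
  pile-rebase-0 z a = cong (_mod N) (+-identityʳ (z + a))

  pile-wraps : ∀ z {e} → e ≡ N → pile z e ≡ pile z 0
  pile-wraps z e≡N = trans (cong (pile z) e≡N) (pile-periodic z 0)

  pile-≡⇒∣ : ∀ z {x y} → pile z x ≡ pile z y → x ≤ y → N ∣ y ∸ x
  pile-≡⇒∣ z {x} {y} eq x≤y = divides (b / N ∸ a / N) (begin
    y ∸ x                                     ≡⟨ [m+n]∸[m+o]≡n∸o z y x ⟨
    b ∸ a
      ≡⟨ cong₂ _∸_ (m≡m%n+[m/n]*n b N) (m≡m%n+[m/n]*n a N) ⟩
    (b % N + b / N * N) ∸ (a % N + a / N * N)
      ≡⟨ cong (λ v → (v + b / N * N) ∸ (a % N + a / N * N)) (mod⇒% eq) ⟨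
    (a % N + b / N * N) ∸ (a % N + a / N * N) ≡⟨ [m+n]∸[m+o]≡n∸o (a % N) (b / N * N) (a / N * N) ⟩
    b / N * N ∸ a / N * N                     ≡⟨ *-distribʳ-∸ N (b / N) (a / N) ⟨
    (b / N ∸ a / N) * N                       ∎)
    where
    open ≡-Reasoning
    a b : ℕ
    a = z + x
    b = z + y

  ∤-small-difference : ∀ {x y} → x < y → y < N → ¬ N ∣ y ∸ x
  ∤-small-difference {x} {y} x<y y<N N∣y∸x =
    <⇒≱ (≤-<-trans (m∸n≤m y x) y<N) (∣⇒≤ {{>-nonZero (m<n⇒0<n∸m x<y)}} N∣y∸x)

  pile-injective : ∀ z {x y} → x < N → y < N → pile z x ≡ pile z y → x ≡ y
  pile-injective z {x} {y} x<N y<N eq with <-cmp x y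
  ... | tri≈ _ x≡y _ = x≡y
  ... | tri< x<y _ _ = contradiction (pile-≡⇒∣ z eq (<⇒≤ x<y)) (∤-small-difference x<y y<N)
  ... | tri> _ _ y<x = contradiction (pile-≡⇒∣ z (sym eq) (<⇒≤ y<x)) (∤-small-difference y<x x<N)

  pile-≢ : ∀ z {x y} → x < N → y < N → x ≢ y → pile z x ≢ pile z y
  pile-≢ z x<N y<N x≢y = x≢y ∘ pile-injective z x<N y<N

  window-surjective : (f : ℕ → Fin N) → (∀ {x y} → x < N → y < N → f x ≡ f y → x ≡ y) →
                      ∀ y → ∃[ e ] e < N × f e ≡ y
  window-surjective f f-inj y with injective⇒surjective (f ∘ toℕ) f∘toℕ-inj y
    where
    f∘toℕ-inj : Injective _≡_ _≡_ (f ∘ toℕ)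
    f∘toℕ-inj eq = toℕ-injective (f-inj (toℕ<n _) (toℕ<n _) eq)
  ... | x , fx≡y = toℕ x , toℕ<n x , fx≡y

  offset : ∀ z y → ∃[ e ] e < N × pile z e ≡ y
  offset z = window-surjective (pile z) (pile-injective z)

  Step : (ℕ → Set) → Fin N → Fin N → Set
  Step S x y = ∃[ s ] S s × pile (toℕ x) s ≡ y

  FixesStep : (ℕ → Set) → Position N → Position N → Set
  FixesStep S M M' = ∃[ x ] ∃[ y ] Step S x y × M' x ≡ M x × M' y ≡ M y

Decreases : ∀ {N} → Position N → Position N → Set
Decreases M M' = (∀ y → M' y ≤ M y) × ∃[ y ] M' y < M y

module _ {N : ℕ} .{{_ : NonZero N}} {S : ℕ → Set} {k : ℕ} where

  move⇒decreases : ∀ {M M'} → Move N S k M M' → Decreases M M'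
  move⇒decreases (_ , _ , _ , _ , _ , M'≤M , _ , lt) = M'≤M , lt

  move⇒sum-< : ∀ {M M'} → Move N S k M M' → sum M' < sum M
  move⇒sum-< mv with M'≤M , y , lt ← move⇒decreases mv = sum-mono-< M'≤M y lt

  module Kernel (P : Position N → Set)
    (independent : ∀ {M M'} → P M → P M' → ¬ Move N S k M M')
    (absorbing : ∀ M → P M ⊎ ∃[ M' ] Move N S k M M' × P M') where

    lose⇔P : ∀ M → (Lose N S k M → P M) × (P M → Lose N S k M)
    lose⇔P M = characterise M (<-wellFounded (sum M))
      where
      characterise : ∀ M → Acc _<_ (sum M) → (Lose N S k M → P M) × (P M → Lose N S k M)
      characterise M (acc smaller) = lose⇒P , P⇒lose
        where
        two-moves : ∀ {M' M''} → Move N S k M M' → Move N S k M' M'' → sum M'' < sum M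
        two-moves mv mv' = <-trans (move⇒sum-< mv') (move⇒sum-< mv)

        lose⇒P : Lose N S k M → P M
        lose⇒P (lose reply) with absorbing M
        ... | inj₁ pM = pM
        ... | inj₂ (M' , mv , pM') with reply M' mv
        ...   | win M'' mv' lost =
          contradiction mv' (independent pM' (proj₁ (characterise M'' (smaller (two-moves mv mv'))) lost))

        P⇒lose : P M → Lose N S k M
        P⇒lose pM = lose answer
          where
          answer : ∀ M' → Move N S k M M' → Win N S k M'
          answer M' mv with absorbing M'
          ... | inj₁ pM' = contradiction mv (independent pM pM')
          ... | inj₂ (M'' , mv' , pM'') =
            win M'' mv' (proj₂ (characterise M'' (smaller (two-moves mv mv'))) pM'')

module PrimeCircle {p : ℕ} (p-prime : Prime p) where

  private instance
    p-nonZero : NonZero p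
    p-nonZero = prime⇒nonZero p-prime

  open Circle p

  walk-distinct : ∀ a {s t t'} → 0 < s → s < p → t < t' → t' < p → pile a (t * s) ≢ pile a (t' * s)
  walk-distinct a {s} {t} {t'} 0<s s<p t<t' t'<p eq
    with euclidsLemma (t' ∸ t) s p-prime
           (subst (p ∣_) (sym (*-distribʳ-∸ s t' t)) (pile-≡⇒∣ a eq (*-monoˡ-≤ s (<⇒≤ t<t'))))
  ... | inj₁ p∣t'∸t = ∤-small-difference t<t' t'<p p∣t'∸t
  ... | inj₂ p∣s    = ∤-small-difference 0<s s<p p∣s

  walk-injective : ∀ a {s} → 0 < s → s < p → ∀ {t t'} → t < p → t' < p →
                   pile a (t * s) ≡ pile a (t' * s) → t ≡ t'
  walk-injective a 0<s s<p {t} {t'} t<p t'<p eq with <-cmp t t'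
  ... | tri≈ _ t≡t' _ = t≡t'
  ... | tri< t<t' _ _ = contradiction eq (walk-distinct a 0<s s<p t<t' t'<p)
  ... | tri> _ _ t'<t = contradiction (sym eq) (walk-distinct a 0<s s<p t'<t t<p)

  walk-surjective : ∀ a {s} → 0 < s → s < p → ∀ y → ∃[ t ] t < p × pile a (t * s) ≡ y
  walk-surjective a {s} 0<s s<p = window-surjective (λ t → pile a (t * s)) (walk-injective a 0<s s<p)

  module _ {S : ℕ → Set} (S-range : ∀ {s} → S s → 0 < s × s < p) where

    move⇒fixesStep : ∀ {M M'} → Move p S (p ∸ 2) M M' → FixesStep S M M'
    move⇒fixesStep (s , Ss , i , j , j<p∸2 , _ , keep , _) =
      x , pile (toℕ x) s , (s , Ss , refl) , keep x (outside (p ∸ 2) j<p∸2 p∸2<p) ,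
      keep (pile (toℕ x) s)
        (outside (suc (p ∸ 2)) (m<n⇒m<1+n j<p∸2) p∸1<p ∘ subst (InGroup p s i j) x+s≡)
      where
      I : ℕ
      I = toℕ i
      x : Fin p
      x = pile I ((p ∸ 2) * s)
      0<s : 0 < s
      0<s = proj₁ (S-range Ss)
      s<p : s < p
      s<p = proj₂ (S-range Ss)
      p∸1<p : suc (p ∸ 2) < p
      p∸1<p = ≤-reflexive (m+[n∸m]≡n (nonTrivial⇒n>1 p {{prime⇒nonTrivial p-prime}}))
      p∸2<p : p ∸ 2 < p
      p∸2<p = <-trans (n<1+n (p ∸ 2)) p∸1<p
      x+s≡ : pile (toℕ x) s ≡ pile I (suc (p ∸ 2) * s)
      x+s≡ = trans (pile-toℕ I ((p ∸ 2) * s) s) (cong (pile I) (+-comm ((p ∸ 2) * s) s))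
      outside : ∀ t → j < t → t < p → ¬ InGroup p s i j (pile I (t * s))
      outside t j<t t<p (t' , t'≤j , eq) = <⇒≢ t'<t (walk-injective I 0<s s<p (<-trans t'<t t<p) t<p (sym eq))
        where
        t'<t : t' < t
        t'<t = ≤-<-trans t'≤j j<t

    -- The group x+2s, x+3s, …, x+(p-1)s covers every pile except x and x+s.
    fixesStep⇒move : 2 < p → ∀ {M M'} → Decreases M M' → FixesStep S M M' → Move p S (p ∸ 2) M M'
    fixesStep⇒move 2<p {M} {M'} (M'≤M , y₀ , lt) (x , y , (s , Ss , x+s≡y) , fix-x , fix-y) =
      s , Ss , pile B (2 * s) , p ∸ 3 , ∸-monoʳ-< ≤-refl 2<p , M'≤M , keep , y₀ , lt
      where
      B : ℕ
      B = toℕ x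
      0<s : 0 < s
      0<s = proj₁ (S-range Ss)
      s<p : s < p
      s<p = proj₂ (S-range Ss)
      covered : ∀ w → w ≢ x → w ≢ y → InGroup p s (pile B (2 * s)) (p ∸ 3) w
      covered w w≢x w≢y with walk-surjective B 0<s s<p w
      ... | 0 , _ , eq = contradiction (trans (sym eq) (pile-toℕ-0 x)) w≢x
      ... | 1 , _ , eq = contradiction (trans (sym eq) (trans (cong (pile B) (+-identityʳ s)) x+s≡y)) w≢y
      ... | suc (suc t) , t+2<p , eq =
        t , ∸-monoˡ-≤ 3 t+2<p ,
        sym (trans (pile-toℕ B (2 * s) (t * s)) (trans (cong (pile B) (sym (*-distribʳ-+ s 2 t))) eq))
      keep : ∀ w → ¬ InGroup p s (pile B (2 * s)) (p ∸ 3) w → M' w ≡ M w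
      keep w w∉ with w ≟ᶠ x | w ≟ᶠ y
      ... | yes refl | _        = fix-x
      ... | no _     | yes refl = fix-y
      ... | no w≢x   | no w≢y   = contradiction (covered w w≢x w≢y) w∉
module Game (m : ℕ) (1<m : 1 < m) where

  N : ℕ
  N = suc (2 * m)

  open Circle N

  ShortStep : Fin N → Fin N → Set
  ShortStep = Step (S₁ m)

  Near : Fin N → Fin N → Set
  Near x y = ShortStep x y ⊎ ShortStep y x

  2m≡m+m : 2 * m ≡ m + m
  2m≡m+m = cong (m +_) (+-identityʳ m)

  1+m+m≡N : suc m + m ≡ N
  1+m+m≡N = cong suc (sym 2m≡m+m)

  m+[1+m]≡N : m + suc m ≡ N
  m+[1+m]≡N = trans (+-comm m (suc m)) 1+m+m≡N

  2m∸m≡m : 2 * m ∸ m ≡ m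
  2m∸m≡m = trans (cong (_∸ m) 2m≡m+m) (m+n∸m≡n m m)

  N∸m≡1+m : N ∸ m ≡ suc m
  N∸m≡1+m = trans (+-∸-assoc 1 (subst (m ≤_) (sym 2m≡m+m) (m≤m+n m m))) (cong suc 2m∸m≡m)

  m<N : m < N
  m<N = s≤s (m≤m+n m (m + 0))

  1+m<2m : suc m < 2 * m
  1+m<2m = subst₂ _<_ (+-comm m 1) (sym 2m≡m+m) (+-monoʳ-< m 1<m)

  -- Offsets from the empty pile n₀ of an element of P: n₀ and the pair n_m, n_{m+1} are special,
  -- every other pile is regular and holds c.
  data SpecialOffset : ℕ → Set where
    empty : SpecialOffset 0
    left  : SpecialOffset m
    right : SpecialOffset (suc m)

  data RegularOffset (r : ℕ) : Set where
    low  : 1 ≤ r → r < m → RegularOffset r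
    high : suc (suc m) ≤ r → r ≤ 2 * m → RegularOffset r

  special≤1+m : ∀ {e} → SpecialOffset e → e ≤ suc m
  special≤1+m empty = z≤n
  special≤1+m left  = n≤1+n m
  special≤1+m right = ≤-refl

  special<N : ∀ {e} → SpecialOffset e → e < N
  special<N sp = ≤-<-trans (special≤1+m sp) (s≤s (<⇒≤ 1+m<2m))

  regular<N : ∀ {r} → RegularOffset r → r < N
  regular<N (low _ r<m)   = <-trans r<m m<N
  regular<N (high _ r≤2m) = s≤s r≤2m

  special-regular-disjoint : ∀ {r} → SpecialOffset r → RegularOffset r → ⊥
  special-regular-disjoint empty (low 1≤0 _)     = <-irrefl refl 1≤0
  special-regular-disjoint empty (high () _)
  special-regular-disjoint left  (low _ m<m)     = <-irrefl refl m<m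
  special-regular-disjoint left  (high 2+m≤m _)  = <-irrefl refl (≤-trans (n≤1+n (suc m)) 2+m≤m)
  special-regular-disjoint right (low _ 1+m<m)   = <-irrefl refl (≤-trans (n≤1+n (suc m)) 1+m<m)
  special-regular-disjoint right (high 2+m≤1+m _) = <-irrefl refl 2+m≤1+m

  special-or-regular-offset : ∀ {r} → r < N → SpecialOffset r ⊎ RegularOffset r
  special-or-regular-offset {zero}  _   = inj₁ empty
  special-or-regular-offset {suc r} r<N with <-cmp (suc r) m
  ... | tri< r<m _ _ = inj₂ (low (s≤s z≤n) r<m)
  ... | tri≈ _ refl _ = inj₁ left
  ... | tri> _ _ m<r with m≤n⇒m<n∨m≡n m<r
  ...   | inj₁ 1+m<r = inj₂ (high 1+m<r (s≤s⁻¹ r<N))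
  ...   | inj₂ refl  = inj₁ right

  data Special (z : ℕ) (y : Fin N) : Set where
    special : ∀ {e} → SpecialOffset e → pile z e ≡ y → Special z y

  Regular : ℕ → Fin N → Set
  Regular z y = ¬ Special z y

  record PAt (M : Position N) (z c : ℕ) : Set where
    constructor mkPAt
    field
      empty-pile    : M (pile z 0) ≡ 0
      pair-sum      : M (pile z m) + M (pile z (suc m)) ≡ c
      regular-piles : ∀ y → Regular z y → M y ≡ c

  IsP : Position N → Set
  IsP M = ∃[ z ] ∃[ c ] PAt M z c

  regularOffset⇒regular : ∀ z {r} → RegularOffset r → Regular z (pile z r)
  regularOffset⇒regular z reg (special sp eq) =
    special-regular-disjoint (subst SpecialOffset (pile-injective z (special<N sp) (regular<N reg) eq) sp) reg

  special-or-regular : ∀ z y → Special z y ⊎ ∃[ r ] RegularOffset r × pile z r ≡ y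
  special-or-regular z y with offset z y
  ... | e , e<N , eq with special-or-regular-offset e<N
  ...   | inj₁ sp  = inj₁ (special sp eq)
  ...   | inj₂ reg = inj₂ (e , reg , eq)

  special? : ∀ z y → Dec (Special z y)
  special? z y with special-or-regular z y
  ... | inj₁ sp               = yes sp
  ... | inj₂ (r , reg , refl) = no (regularOffset⇒regular z reg)

  regular? : ∀ z y → Dec (Regular z y)
  regular? z y = ¬? (special? z y)

  regular⇒offset : ∀ z {y} → Regular z y → ∃[ r ] RegularOffset r × pile z r ≡ y
  regular⇒offset z {y} reg with special-or-regular z y
  ... | inj₁ sp    = contradiction sp reg
  ... | inj₂ found = found

  step-forward : ∀ z {e e'} → e < e' → e' ∸ e < m → ShortStep (pile z e) (pile z e')
  step-forward z {e} {e'} e<e' gap =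
    e' ∸ e , (m<n⇒0<n∸m e<e' , gap) ,
    trans (pile-toℕ z e (e' ∸ e)) (cong (pile z) (m+[n∸m]≡n (<⇒≤ e<e')))

  left-step-right : ∀ z → ShortStep (pile z m) (pile z (suc m))
  left-step-right z = step-forward z (n<1+n m) (subst (_< m) (sym (m+n∸n≡m 1 m)) 1<m)

  near-left : ∀ z {w} → Regular z w → w ≢ pile z (2 * m) → Near w (pile z m)
  near-left z {w} reg w≢2m with regular⇒offset z reg
  ... | r , low 1≤r r<m , eq = subst (λ v → Near v (pile z m)) eq
    (inj₁ (step-forward z r<m (∸-monoʳ-< {m} {r} {0} 1≤r (<⇒≤ r<m))))
  ... | r , high 2+m≤r r≤2m , eq = subst (λ v → Near v (pile z m)) eq
    (inj₂ (step-forward z m<r (subst (r ∸ m <_) 2m∸m≡m (∸-monoˡ-< r<2m (<⇒≤ m<r)))))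
    where
    m<r : m < r
    m<r = ≤-trans (n≤1+n (suc m)) 2+m≤r
    r<2m : r < 2 * m
    r<2m = ≤∧≢⇒< r≤2m (λ r≡2m → w≢2m (trans (sym eq) (cong (pile z) r≡2m)))

  near-right : ∀ z {w} → Regular z w → w ≢ pile z 1 → Near w (pile z (suc m))
  near-right z {w} reg w≢1 with regular⇒offset z reg
  ... | r , low 1≤r r<m , eq = subst (λ v → Near v (pile z (suc m))) eq
    (inj₁ (step-forward z (m<n⇒m<1+n r<m) (∸-monoʳ-< {suc m} {r} {1} 1<r (<⇒≤ (m<n⇒m<1+n r<m)))))
    where
    1<r : 1 < r
    1<r = ≤∧≢⇒< 1≤r (λ 1≡r → w≢1 (trans (sym eq) (cong (pile z) (sym 1≡r))))
  ... | r , high 2+m≤r r≤2m , eq = subst (λ v → Near v (pile z (suc m))) eq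
    (inj₂ (step-forward z 2+m≤r
      (subst (r ∸ suc m <_) 2m∸m≡m (∸-monoˡ-< (s≤s r≤2m) (<⇒≤ 2+m≤r)))))

  near-left-or-right : ∀ z {w} → Regular z w → Near w (pile z m) ⊎ Near w (pile z (suc m))
  near-left-or-right z {w} reg with w ≟ᶠ pile z (2 * m)
  ... | no w≢2m   = inj₁ (near-left z reg w≢2m)
  ... | yes refl  = inj₂ (near-right z reg (pile-≢ z ≤-refl (<-trans 1<m m<N) 2m≢1))
    where
    2m≢1 : 2 * m ≢ 1
    2m≢1 = >⇒≢ (<-trans 1<m (<-trans (n<1+n m) 1+m<2m))

  special+short<N : ∀ {e s} → SpecialOffset e → s < m → e + s < N
  special+short<N {e} {s} sp s<m = subst (e + s <_) 1+m+m≡N (+-mono-≤-< (special≤1+m sp) s<m)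

  short-gap-between-specials : ∀ {e e' s} → SpecialOffset e → SpecialOffset e' → 1 ≤ s → s < m →
                               e + s ≡ e' → e ≡ m × e' ≡ suc m
  short-gap-between-specials empty empty 1≤s _   eq = contradiction (sym eq) (<⇒≢ 1≤s)
  short-gap-between-specials empty left  _   s<m eq = contradiction eq (<⇒≢ s<m)
  short-gap-between-specials empty right _   s<m eq = contradiction eq (<⇒≢ (m<n⇒m<1+n s<m))
  short-gap-between-specials left  empty 1≤s _   eq = contradiction eq (>⇒≢ (<-≤-trans 1≤s (m≤n+m _ m)))
  short-gap-between-specials left  left  1≤s _   eq = contradiction (sym eq) (<⇒≢ (m<m+n m 1≤s))
  short-gap-between-specials left  right _   _   _  = refl , refl
  short-gap-between-specials right sp'   1≤s _   eq =
    contradiction (subst (_≤ suc m) (sym eq) (special≤1+m sp')) (<⇒≱ (m<m+n (suc m) 1≤s))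

  short-step-between-specials : ∀ z {x y} → Special z x → Special z y → ShortStep x y →
                                x ≡ pile z m × y ≡ pile z (suc m)
  short-step-between-specials z (special {e} sp x≡) (special sp' y≡) (s , (1≤s , s<m) , step)
    with short-gap-between-specials sp sp' 1≤s s<m
           (pile-injective z (special+short<N sp s<m) (special<N sp')
             (trans (sym (pile-toℕ z e s))
               (trans (cong (λ v → pile (toℕ v) s) x≡) (trans step (sym y≡)))))
  ... | e≡m , e'≡1+m = trans (sym x≡) (cong (pile z) e≡m) , trans (sym y≡) (cong (pile z) e'≡1+m)

  PAt-bounded : ∀ {M z c} → PAt M z c → ∀ y → M y ≤ c
  PAt-bounded {M} {z} {c} (mkPAt empty≡0 pair≡c regular≡c) y with special? z y
  ... | no reg                   = ≤-reflexive (regular≡c y reg)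
  ... | yes (special empty refl) = ≤-trans (≤-reflexive empty≡0) z≤n
  ... | yes (special left  refl) = ≤-trans (m≤m+n _ _) (≤-reflexive pair≡c)
  ... | yes (special right refl) = ≤-trans (m≤n+m _ _) (≤-reflexive pair≡c)

  regular-if-distinct : ∀ {z y} → y ≢ pile z 0 → y ≢ pile z m → y ≢ pile z (suc m) → Regular z y
  regular-if-distinct y≢0 _ _ (special empty eq) = y≢0 (sym eq)
  regular-if-distinct _ y≢m _ (special left eq) = y≢m (sym eq)
  regular-if-distinct _ _ y≢1+m (special right eq) = y≢1+m (sym eq)

  left≢empty : ∀ z → pile z m ≢ pile z 0
  left≢empty z = pile-≢ z m<N (s≤s z≤n) (>⇒≢ (<-trans (s≤s z≤n) 1<m))

  right≢empty : ∀ z → pile z (suc m) ≢ pile z 0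
  right≢empty z = pile-≢ z (special<N right) (s≤s z≤n) (λ ())

  right≢left : ∀ z → pile z (suc m) ≢ pile z m
  right≢left z = pile-≢ z (special<N right) m<N (>⇒≢ (n<1+n m))

  -- Resetting the empty pile and the pair to c adds 2c tokens and leaves the constant position c.
  reset-PAt : ℕ → ℕ → Position N → Position N
  reset-PAt z c M =
    updateAt (updateAt (updateAt M (pile z 0) (const c)) (pile z m) (const c)) (pile z (suc m)) (const c)

  reset-PAt-const : ∀ {M z c} → PAt M z c → ∀ y → reset-PAt z c M y ≡ c
  reset-PAt-const {M} {z} {c} pM y with y ≟ᶠ pile z (suc m) | y ≟ᶠ pile z m | y ≟ᶠ pile z 0
  ... | yes refl | _        | _        = updateAt-updates (pile z (suc m)) _
  ... | no ≢1+m  | yes refl | _        = trans (updateAt-minimal y _ _ ≢1+m) (updateAt-updates (pile z m) _)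
  ... | no ≢1+m  | no ≢m    | yes refl =
    trans (updateAt-minimal y _ _ ≢1+m) (trans (updateAt-minimal y _ _ ≢m) (updateAt-updates (pile z 0) M))
  ... | no ≢1+m  | no ≢m    | no ≢0    =
    trans (updateAt-minimal y _ _ ≢1+m) (trans (updateAt-minimal y _ _ ≢m)
      (trans (updateAt-minimal y _ M ≢0) (PAt.regular-piles pM y (regular-if-distinct ≢0 ≢m ≢1+m))))

  sum-PAt : ∀ {M z c} → PAt M z c → sum M ≡ (N ∸ 2) * c
  sum-PAt {M} {z} {c} pM@(mkPAt empty≡0 pair≡c _) = begin
    sum M                   ≡⟨ m+n∸n≡m (sum M) (2 * c) ⟨
    sum M + 2 * c ∸ 2 * c   ≡⟨ cong (_∸ 2 * c) sum+2c ⟩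
    N * c ∸ 2 * c           ≡⟨ *-distribʳ-∸ c N 2 ⟨
    (N ∸ 2) * c             ∎
    where
    open ≡-Reasoning
    M₁ M₂ : Position N
    M₁ = updateAt M (pile z 0) (const c)
    M₂ = updateAt M₁ (pile z m) (const c)
    L R : ℕ
    L = M (pile z m)
    R = M (pile z (suc m))
    step₁ : sum M₁ ≡ sum M + c
    step₁ = trans (sym (+-identityʳ (sum M₁)))
                  (trans (cong (sum M₁ +_) (sym empty≡0)) (sum-updateAt M _ (const c)))
    step₂ : sum M₂ + L ≡ sum M₁ + c
    step₂ = trans (cong (sum M₂ +_) (sym (updateAt-minimal _ _ M (left≢empty z))))
                  (sum-updateAt M₁ _ (const c))
    step₃ : sum (reset-PAt z c M) + R ≡ sum M₂ + c
    step₃ = trans (cong (sum (reset-PAt z c M) +_)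
                        (sym (trans (updateAt-minimal _ _ M₁ (right≢left z))
                                    (updateAt-minimal _ _ M (right≢empty z)))))
                  (sum-updateAt M₂ _ (const c))
    sum-reset : sum (reset-PAt z c M) ≡ N * c
    sum-reset = trans (sum-cong-≗ (reset-PAt-const pM)) (sum-const N c)
    regroup : ∀ s c → s + 2 * c + c ≡ s + c + c + c
    regroup = solve-∀
    sum+2c : sum M + 2 * c ≡ N * c
    sum+2c = +-cancelʳ-≡ c _ _ (begin
      sum M + 2 * c + c              ≡⟨ regroup (sum M) c ⟩
      sum M + c + c + c              ≡⟨ cong (λ v → v + c + c) step₁ ⟨
      sum M₁ + c + c                 ≡⟨ cong (_+ c) step₂ ⟨
      sum M₂ + L + c                 ≡⟨ xy∙z≈xz∙y (sum M₂) L c ⟩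
      sum M₂ + c + L                 ≡⟨ cong (_+ L) step₃ ⟨
      sum (reset-PAt z c M) + R + L  ≡⟨ xy∙z≈x∙zy (sum (reset-PAt z c M)) R L ⟩
      sum (reset-PAt z c M) + (L + R) ≡⟨ cong₂ _+_ sum-reset pair≡c ⟩
      N * c + c                      ∎)

  empty-opposite-pair-≤ : ∀ {M z c} → PAt M z c → ∀ x → M (pile x 0) ≡ 0 →
                          M (pile x m) + M (pile x (suc m)) ≤ c
  empty-opposite-pair-≤ {M} {z} {c} pM@(mkPAt empty≡0 pair≡c regular≡c) x x-empty
    with special? z (pile x 0)
  ... | yes (special empty eq) = ≤-reflexive (trans (cong₂ _+_ (same m) (same (suc m))) pair≡c)
    where
    same : ∀ e → M (pile x e) ≡ M (pile z e)
    same e = cong M (pile-shift x 0 z 0 e (sym eq))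
  ... | yes (special left eq) =
    ≤-trans (≤-reflexive (trans (cong (M (pile x m) +_) right-empty) (+-identityʳ _))) (PAt-bounded pM _)
    where
    right-empty : M (pile x (suc m)) ≡ 0
    right-empty = trans (cong M (trans (pile-shift x 0 z m (suc m) (sym eq)) (pile-wraps z m+[1+m]≡N))) empty≡0
  ... | yes (special right eq) =
    ≤-trans (≤-reflexive (cong (_+ M (pile x (suc m))) left-empty)) (PAt-bounded pM _)
    where
    left-empty : M (pile x m) ≡ 0
    left-empty = trans (cong M (trans (pile-shift x 0 z (suc m) m (sym eq)) (pile-wraps z 1+m+m≡N))) empty≡0
  ... | no reg = ≤-trans (+-mono-≤ (PAt-bounded pM _) (PAt-bounded pM _)) (≤-reflexive (cong (_+ c) c≡0))
    where
    c≡0 : c ≡ 0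
    c≡0 = trans (sym (regular≡c _ reg)) x-empty

  P-independent : ∀ {M M' z c z' c'} → PAt M z c → PAt M' z' c' →
                  Decreases M M' → ¬ FixesStep (S₁ m) M M'
  P-independent {M} {M'} {z} {c} {z'} {c'} pM@(mkPAt empty≡0 pair≡c regular≡c) pM'
                (M'≤M , y₀ , M'y₀<My₀) (x , y , step , fix-x , fix-y) = <⇒≱ c'<c c≤c'
    where
    c'<c : c' < c
    c'<c = *-cancelˡ-< (N ∸ 2) c' c
             (subst₂ _<_ (sum-PAt pM') (sum-PAt pM) (sum-mono-< M'≤M y₀ M'y₀<My₀))
    fixed⇒special : ∀ {w} → M' w ≡ M w → Special z w
    fixed⇒special {w} fixed with special? z w
    ... | yes sp = sp
    ... | no reg =
      contradiction (PAt-bounded pM' w) (<⇒≱ (subst (c' <_) (sym (trans fixed (regular≡c w reg))) c'<c))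
    ends : x ≡ pile z m × y ≡ pile z (suc m)
    ends = short-step-between-specials z (fixed⇒special fix-x) (fixed⇒special fix-y) step
    M'-empty : M' (pile z 0) ≡ 0
    M'-empty = n≤0⇒n≡0 (subst (M' (pile z 0) ≤_) empty≡0 (M'≤M (pile z 0)))
    c≤c' : c ≤ c'
    c≤c' = begin
      c                                   ≡⟨ pair≡c ⟨
      M (pile z m) + M (pile z (suc m))   ≡⟨ cong₂ _+_ (subst (λ v → M' v ≡ M v) (proj₁ ends) fix-x)
                                                       (subst (λ v → M' v ≡ M v) (proj₂ ends) fix-y) ⟨
      M' (pile z m) + M' (pile z (suc m)) ≤⟨ empty-opposite-pair-≤ pM' z M'-empty ⟩
      c'                                  ∎
      where open ≤-Reasoning

  target : ℕ → ℕ → ℕ → Position N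
  target z α β y with y ≟ᶠ pile z 0 | y ≟ᶠ pile z m | y ≟ᶠ pile z (suc m)
  ... | yes _ | _     | _     = 0
  ... | no _  | yes _ | _     = α
  ... | no _  | no _  | yes _ = β
  ... | no _  | no _  | no _  = α + β

  target-empty : ∀ z α β → target z α β (pile z 0) ≡ 0
  target-empty z α β with pile z 0 ≟ᶠ pile z 0
  ... | yes _  = refl
  ... | no ≢0 = contradiction refl ≢0

  target-left : ∀ z α β → target z α β (pile z m) ≡ α
  target-left z α β with pile z m ≟ᶠ pile z 0 | pile z m ≟ᶠ pile z m
  ... | yes ≡0 | _      = contradiction ≡0 (left≢empty z)
  ... | no _   | yes _  = refl
  ... | no _   | no ≢m = contradiction refl ≢m

  target-right : ∀ z α β → target z α β (pile z (suc m)) ≡ β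
  target-right z α β
    with pile z (suc m) ≟ᶠ pile z 0 | pile z (suc m) ≟ᶠ pile z m | pile z (suc m) ≟ᶠ pile z (suc m)
  ... | yes ≡0 | _      | _         = contradiction ≡0 (right≢empty z)
  ... | no _   | yes ≡m | _         = contradiction ≡m (right≢left z)
  ... | no _   | no _   | yes _     = refl
  ... | no _   | no _   | no ≢1+m  = contradiction refl ≢1+m

  target-regular : ∀ z α β {y} → Regular z y → target z α β y ≡ α + β
  target-regular z α β {y} reg with y ≟ᶠ pile z 0 | y ≟ᶠ pile z m | y ≟ᶠ pile z (suc m)
  ... | yes ≡0 | _      | _        = contradiction (special empty (sym ≡0)) reg
  ... | no _   | yes ≡m | _        = contradiction (special left (sym ≡m)) reg
  ... | no _   | no _   | yes ≡1+m = contradiction (special right (sym ≡1+m)) reg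
  ... | no _   | no _   | no _     = refl

  target-PAt : ∀ z α β → PAt (target z α β) z (α + β)
  target-PAt z α β = mkPAt (target-empty z α β) (cong₂ _+_ (target-left z α β) (target-right z α β))
                           (λ y → target-regular z α β)

  target-≤ : ∀ {M : Position N} z {α β} → α ≤ M (pile z m) → β ≤ M (pile z (suc m)) →
             (∀ y → Regular z y → α + β ≤ M y) → ∀ y → target z α β y ≤ M y
  target-≤ {M} z {α} {β} α≤ β≤ α+β≤ y with special? z y
  ... | no reg                 = subst (_≤ M y) (sym (target-regular z α β reg)) (α+β≤ y reg)
  ... | yes (special empty refl) = subst (_≤ M (pile z 0)) (sym (target-empty z α β)) z≤n
  ... | yes (special left  refl) = subst (_≤ M (pile z m)) (sym (target-left z α β)) α≤
  ... | yes (special right refl) = subst (_≤ M (pile z (suc m))) (sym (target-right z α β)) β≤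

  PAt-cong : ∀ {A B z c} → (∀ y → A y ≡ B y) → PAt A z c → PAt B z c
  PAt-cong {A} {B} {z} A≗B (mkPAt empty≡0 pair≡c regular≡c) =
    mkPAt (trans (sym (A≗B (pile z 0))) empty≡0)
          (trans (sym (cong₂ _+_ (A≗B (pile z m)) (A≗B (pile z (suc m))))) pair≡c)
          (λ y reg → trans (sym (A≗B y)) (regular≡c y reg))

  near⇒fixesStep : ∀ {M M' x y} → Near x y → M' x ≡ M x → M' y ≡ M y → FixesStep (S₁ m) M M'
  near⇒fixesStep {x = x} {y} (inj₁ step) fix-x fix-y = x , y , step , fix-x , fix-y
  near⇒fixesStep {x = x} {y} (inj₂ step) fix-x fix-y = y , x , step , fix-y , fix-x

  Absorbed : Position N → Set
  Absorbed M = IsP M ⊎ ∃[ M' ] Decreases M M' × FixesStep (S₁ m) M M' × IsP M'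

  absorbed-via-target : ∀ {M} z {α β} → α ≤ M (pile z m) → β ≤ M (pile z (suc m)) →
                        (∀ y → Regular z y → α + β ≤ M y) →
                        ∀ {x y} → Near x y → target z α β x ≡ M x → target z α β y ≡ M y →
                        Absorbed M
  absorbed-via-target {M} z {α} {β} α≤ β≤ α+β≤ near fix-x fix-y
    with any? (λ w → target z α β w <? M w)
  ... | yes (w , T<M) = inj₂ (target z α β , (target-≤ {M} z α≤ β≤ α+β≤ , w , T<M) ,
                              near⇒fixesStep near fix-x fix-y , z , α + β , target-PAt z α β)
  ... | no ∄T<M = inj₁ (z , α + β , PAt-cong T≗M (target-PAt z α β))
    where
    T≗M : ∀ w → target z α β w ≡ M w
    T≗M w = ≤-antisym (target-≤ {M} z α≤ β≤ α+β≤ w) (≮⇒≥ (λ T<M → ∄T<M (w , T<M)))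

  module _ {M : Position N} (z : ℕ) where

    private
      L R : ℕ
      L = M (pile z m)
      R = M (pile z (suc m))

    LeastRegular : Fin N → Set
    LeastRegular w = Regular z w × (∀ y → Regular z y → M w ≤ M y)

    absorbed-by-pair : (∀ y → Regular z y → L + R ≤ M y) → Absorbed M
    absorbed-by-pair L+R≤ = absorbed-via-target z ≤-refl ≤-refl L+R≤ (inj₁ (left-step-right z))
                              (target-left z L R) (target-right z L R)

    absorbed-by-left : ∀ {w} → LeastRegular w → L ≤ M w → M w ≤ L + R → Near w (pile z m) →
                       Absorbed M
    absorbed-by-left {w} (reg , w-min) L≤w w≤L+R near =
      absorbed-via-target z ≤-refl β≤R (λ y reg-y → subst (_≤ M y) (sym L+β≡w) (w-min y reg-y))
        near (trans (target-regular z L β reg) L+β≡w) (target-left z L β)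
      where
      β : ℕ
      β = M w ∸ L
      L+β≡w : L + β ≡ M w
      L+β≡w = m+[n∸m]≡n L≤w
      β≤R : β ≤ R
      β≤R = subst (β ≤_) (m+n∸m≡n L R) (∸-monoˡ-≤ L w≤L+R)

    absorbed-by-right : ∀ {w} → LeastRegular w → R ≤ M w → M w ≤ L + R → Near w (pile z (suc m)) →
                        Absorbed M
    absorbed-by-right {w} (reg , w-min) R≤w w≤L+R near =
      absorbed-via-target z α≤L ≤-refl (λ y reg-y → subst (_≤ M y) (sym α+R≡w) (w-min y reg-y))
        near (trans (target-regular z α R reg) α+R≡w) (target-right z α R)
      where
      α : ℕ
      α = M w ∸ R
      α+R≡w : α + R ≡ M w
      α+R≡w = m∸n+n≡m R≤w
      α≤L : α ≤ L
      α≤L = subst (α ≤_) (m+n∸n≡m L R) (∸-monoˡ-≤ R w≤L+R)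

    absorbed-at-least : ∀ {w} → LeastRegular w →
                        (L ≤ M w × Near w (pile z m)) ⊎ (R ≤ M w × Near w (pile z (suc m))) → Absorbed M
    absorbed-at-least {w} least side with L + R ≤? M w
    ... | yes L+R≤w = absorbed-by-pair (λ y reg-y → ≤-trans L+R≤w (proj₂ least y reg-y))
    ... | no L+R≰w with side
    ...   | inj₁ (L≤w , near) = absorbed-by-left least L≤w (<⇒≤ (≰⇒> L+R≰w)) near
    ...   | inj₂ (R≤w , near) = absorbed-by-right least R≤w (<⇒≤ (≰⇒> L+R≰w)) near

    absorbed-if-pair-small : ∀ {w} → LeastRegular w → L ≤ M w → R ≤ M w → Absorbed M
    absorbed-if-pair-small least L≤w R≤w =
      absorbed-at-least least (Sum.map (L≤w ,_) (R≤w ,_) (near-left-or-right z (proj₁ least)))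

    least-regular : ∃[ w ] LeastRegular w
    least-regular = minimiser (regular? z) M (regularOffset⇒regular z (low ≤-refl 1<m))

    absorbed-or-right-obstruction : (∀ y → R ≤ M y) →
                                    Absorbed M ⊎ (M (pile z 1) < L × LeastRegular (pile z 1))
    absorbed-or-right-obstruction R-min with least-regular
    ... | w , least with L ≤? M w
    ...   | yes L≤w = inj₁ (absorbed-if-pair-small least L≤w (R-min w))
    ...   | no L≰w with w ≟ᶠ pile z 1
    ...     | no w≢1   = inj₁ (absorbed-at-least least (inj₂ (R-min w , near-right z (proj₁ least) w≢1)))
    ...     | yes refl = inj₂ (≰⇒> L≰w , least)

    absorbed-or-left-obstruction : (∀ y → L ≤ M y) →
                                   Absorbed M ⊎ (M (pile z (2 * m)) < R × LeastRegular (pile z (2 * m)))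
    absorbed-or-left-obstruction L-min with least-regular
    ... | w , least with R ≤? M w
    ...   | yes R≤w = inj₁ (absorbed-if-pair-small least (L-min w) R≤w)
    ...   | no R≰w with w ≟ᶠ pile z (2 * m)
    ...     | no w≢2m  = inj₁ (absorbed-at-least least (inj₁ (L-min w , near-left z (proj₁ least) w≢2m)))
    ...     | yes refl = inj₂ (≰⇒> R≰w , least)

  right-of-shift-m : ∀ u → pile (u + m) (suc m) ≡ pile u 0
  right-of-shift-m u = trans (pile-rebase u m (suc m)) (pile-wraps u m+[1+m]≡N)

  left-of-shift-1+m : ∀ u → pile (u + suc m) m ≡ pile u 0
  left-of-shift-1+m u = trans (pile-rebase u (suc m) m) (pile-wraps u 1+m+m≡N)

  regular-shift-m : ∀ {u w} → Regular u w → w ≢ pile (u + m) m → Regular (u + m) w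
  regular-shift-m {u} reg w≢ (special empty eq) = reg (special left (trans (sym (pile-rebase-0 u m)) eq))
  regular-shift-m {u} reg w≢ (special left  eq) = w≢ (sym eq)
  regular-shift-m {u} reg w≢ (special right eq) = reg (special empty (trans (sym (right-of-shift-m u)) eq))

  regular-shift-1+m : ∀ {u w} → Regular u w → w ≢ pile (u + suc m) (suc m) → Regular (u + suc m) w
  regular-shift-1+m {u} reg w≢ (special empty eq) =
    reg (special right (trans (sym (pile-rebase-0 u (suc m))) eq))
  regular-shift-1+m {u} reg w≢ (special left  eq) = reg (special empty (trans (sym (left-of-shift-1+m u)) eq))
  regular-shift-1+m {u} reg w≢ (special right eq) = w≢ (sym eq)

  -- With u a smallest pile, the obstructions at bases u+m and u+m+1 make the two piles at
  -- distance m from u minimal among the regular piles of base u.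
  absorbed-from-minimum : ∀ {M : Position N} u → (∀ y → M (pile u 0) ≤ M y) → Absorbed M
  absorbed-from-minimum {M} u u-min
    with absorbed-or-right-obstruction (u + m) (minimum-at (right-of-shift-m u))
       | absorbed-or-left-obstruction (u + suc m) (minimum-at (left-of-shift-1+m u))
       | least-regular u
    where
    minimum-at : ∀ {x} → x ≡ pile u 0 → ∀ y → M x ≤ M y
    minimum-at x≡u = subst (λ v → ∀ y → M v ≤ M y) (sym x≡u) u-min
  ... | inj₁ absorbed | _             | _ = absorbed
  ... | inj₂ _        | inj₁ absorbed | _ = absorbed
  ... | inj₂ (gap₁ , _ , min₁) | inj₂ (gap₂ , _ , min₂) | w₀ , least₀@(reg₀ , _) =
    absorbed-if-pair-small u least₀ L≤w₀ R≤w₀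
    where
    after-right : pile (u + m) 1 ≡ pile u (suc m)
    after-right = trans (pile-rebase u m 1) (cong (pile u) (+-comm m 1))
    before-left : pile (u + suc m) (2 * m) ≡ pile u m
    before-left = trans (pile-rebase u (suc m) (2 * m))
                        (trans (cong (pile u) (sym (+-suc m (2 * m)))) (pile-periodic u m))
    R≤w₀ : M (pile u (suc m)) ≤ M w₀
    R≤w₀ with w₀ ≟ᶠ pile (u + m) m
    ... | yes w₀≡ = <⇒≤ (subst₂ (λ a b → M a < M b) after-right (sym w₀≡) gap₁)
    ... | no w₀≢  = subst (λ v → M v ≤ M w₀) after-right (min₁ w₀ (regular-shift-m reg₀ w₀≢))
    L≤w₀ : M (pile u m) ≤ M w₀
    L≤w₀ with w₀ ≟ᶠ pile (u + suc m) (suc m)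
    ... | yes w₀≡ = <⇒≤ (subst₂ (λ a b → M a < M b) before-left (sym w₀≡) gap₂)
    ... | no w₀≢  = subst (λ v → M v ≤ M w₀) before-left (min₂ w₀ (regular-shift-1+m reg₀ w₀≢))

  absorbed : ∀ M → Absorbed M
  absorbed M with minimiser {P = λ _ → ⊤} (λ _ → yes tt) M {fzero} tt
  ... | v , _ , v-min =
    absorbed-from-minimum (toℕ v) (λ y → subst (λ x → M x ≤ M y) (sym (pile-toℕ-0 v)) (v-min y tt))

  reflect-regular : ∀ {r} → RegularOffset r → RegularOffset (N ∸ r)
  reflect-regular {r} (low 1≤r r<m) =
    high (m+n≤o⇒m≤o∸n (suc (suc m)) (s≤s (subst₂ _≤_ (+-suc m r) (sym 2m≡m+m) (+-monoʳ-≤ m r<m))))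
         (∸-monoʳ-≤ N 1≤r)
  reflect-regular {r} (high 2+m≤r r≤2m) =
    low (m<n⇒0<n∸m (s≤s r≤2m))
        (≤-<-trans (∸-monoʳ-≤ N 2+m≤r)
          (subst (2 * m ∸ suc m <_) 2m∸m≡m (∸-monoʳ-< (n<1+n m) (<⇒≤ 1+m<2m))))

  Pattern : (ℕ → ℕ) → ℕ → Set
  Pattern f c = f 0 ≡ 0 × f m + f (suc m) ≡ c × (∀ r → RegularOffset r → f r ≡ c)

  PSet⇒pattern : ∀ x → PSet m x → ∃[ c ] Pattern (λ r → x (r mod N)) c
  PSet⇒pattern x (at0 , c , lows , pair , highs) = c , at0 , pair , regulars
    where
    regulars : ∀ r → RegularOffset r → x (r mod N) ≡ c
    regulars r (low 1≤r r<m)      = lows r 1≤r r<m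
    regulars r (high 2+m≤r r≤2m) = highs r 2+m≤r r≤2m

  pattern⇒PSet : ∀ x {c} → Pattern (λ r → x (r mod N)) c → PSet m x
  pattern⇒PSet x {c} (at0 , pair , regulars) =
    at0 , c , (λ r 1≤r r<m → regulars r (low 1≤r r<m)) , pair ,
    (λ r 2+m≤r r≤2m → regulars r (high 2+m≤r r≤2m))

  pattern-cong : ∀ {f g c} → (∀ r → r < N → f r ≡ g r) → Pattern f c → Pattern g c
  pattern-cong f≗g (f0 , pair , regulars) =
    trans (sym (f≗g 0 (s≤s z≤n))) f0 ,
    trans (sym (cong₂ _+_ (f≗g m m<N) (f≗g (suc m) (special<N right)))) pair ,
    λ r reg → trans (sym (f≗g r (regular<N reg))) (regulars r reg)

  pattern-reflect : ∀ {f c} → f N ≡ f 0 → Pattern (λ r → f (N ∸ r)) c → Pattern f c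
  pattern-reflect {f} fN≡f0 (g0 , pair , regulars) =
    trans (sym fN≡f0) g0 ,
    trans (cong₂ _+_ (cong f (sym 2m∸m≡m)) (cong f (sym N∸m≡1+m)))
          (trans (+-comm (f (N ∸ suc m)) (f (N ∸ m))) pair) ,
    λ r reg → trans (cong f (sym (m∸[m∸n]≡n (<⇒≤ (regular<N reg)))))
                    (regulars (N ∸ r) (reflect-regular reg))

  pattern⇒PAt : ∀ {M z c} → Pattern (λ r → M (pile z r)) c → PAt M z c
  pattern⇒PAt {M} {z} {c} (empty≡0 , pair≡c , regulars) = mkPAt empty≡0 pair≡c regular≡c
    where
    regular≡c : ∀ y → Regular z y → M y ≡ c
    regular≡c y reg with regular⇒offset z reg
    ... | r , ro , eq = trans (cong M (sym eq)) (regulars r ro)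

  PAt⇒pattern : ∀ {M z c} → PAt M z c → Pattern (λ r → M (pile z r)) c
  PAt⇒pattern {z = z} (mkPAt empty≡0 pair≡c regular≡c) =
    empty≡0 , pair≡c , λ r ro → regular≡c (pile z r) (regularOffset⇒regular z ro)

  ∈↺⇒IsP : ∀ {M} → M ∈↺ PSet m → IsP M
  ∈↺⇒IsP {M} (i , inj₁ rotated) with PSet⇒pattern (λ r → M (pile (toℕ i) (toℕ r))) rotated
  ... | c , pat = toℕ i , c , pattern⇒PAt (pattern-cong (λ r _ → cong M (pile-mod (toℕ i) r)) pat)
  ∈↺⇒IsP {M} (i , inj₂ reflected)
    with PSet⇒pattern (λ r → M (pile (toℕ i) (N ∸ toℕ r))) reflected
  ... | c , pat =
    toℕ i , c , pattern⇒PAt (pattern-reflect (cong M (pile-periodic (toℕ i) 0)) (pattern-cong unreduce pat))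
    where
    unreduce : ∀ r → r < N → M (pile (toℕ i) (N ∸ toℕ (r mod N))) ≡ M (pile (toℕ i) (N ∸ r))
    unreduce r r<N = cong (λ v → M (pile (toℕ i) (N ∸ v))) (trans (toℕ-mod r) (m<n⇒m%n≡m r<N))

  IsP⇒∈↺ : ∀ {M} → IsP M → M ∈↺ PSet m
  IsP⇒∈↺ {M} (z , c , pM) =
    pile z 0 , inj₁ (pattern⇒PSet x (pattern-cong recentre (PAt⇒pattern pM)))
    where
    x : Fin N → ℕ
    x r = M (pile (toℕ (pile z 0)) (toℕ r))
    recentre : ∀ r → r < N → M (pile z r) ≡ x (r mod N)
    recentre r _ = cong M (sym (trans (pile-toℕ z 0 (toℕ (r mod N))) (pile-mod z r)))

  module _ (N-prime : Prime N) where

    open PrimeCircle N-prime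

    private
      short-range : ∀ {s} → S₁ m s → 0 < s × s < N
      short-range (1≤s , s<m) = 1≤s , <-trans s<m m<N

      2<N : 2 < N
      2<N = s≤s (≤-trans 1<m (m≤m+n m (m + 0)))

    IsP-independent : ∀ {M M'} → IsP M → IsP M' → ¬ Move N (S₁ m) (2 * m ∸ 1) M M'
    IsP-independent (_ , _ , pM) (_ , _ , pM') mv =
      P-independent pM pM' (move⇒decreases mv) (move⇒fixesStep short-range mv)

    IsP-absorbing : ∀ M → IsP M ⊎ ∃[ M' ] Move N (S₁ m) (2 * m ∸ 1) M M' × IsP M'
    IsP-absorbing M = Sum.map₂ (λ (M' , dec , fix , pM') → M' , fixesStep⇒move short-range 2<N dec fix , pM')
                               (absorbed M)

mainTheorem13 : (m : ℕ) → 1 < m → Prime (suc (2 * m)) →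
    (M : Position (suc (2 * m))) →
    (PPosition (suc (2 * m)) (S₁ m) (2 * m ∸ 1) M → M ∈↺ PSet m) ×
    (M ∈↺ PSet m → PPosition (suc (2 * m)) (S₁ m) (2 * m ∸ 1) M)
mainTheorem13 m 1<m N-prime M = IsP⇒∈↺ ∘ proj₁ (lose⇔P M) , proj₂ (lose⇔P M) ∘ ∈↺⇒IsP
  where
  open Game m 1<m
  open Kernel IsP (IsP-independent N-prime) (IsP-absorbing N-prime)
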